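{- Let $n=2^k-1$, let $C \subseteq F^n$ be a binary perfect code containing $0^n$, let $\lambda : C \to \{0,1\}$ with $\lambda(0^n)=0$, and let $V_C^\lambda = \{(x+y, |x|+\lambda(y), x): x \in F^n, y\in C\}$. Suppose $x\in F^n$, $y\in C$ and $z = (x+y, |x|, x)$ is a codeword of $V_C^\lambda$. Define $\theta : \mathrm{STS}(C,y) \to \{0,1\}$ by $\theta(\mathrm{supp}(y+y')) = \lambda(y) + \lambda(y')$ for $y' \in C$ with $d(y,y')=3$. Then $\mathrm{STS}(V_C^\lambda, z) = \mathrm{STS}(C,y)^\theta$.
   Context: For a code $D$ and a codeword $w$, $\mathrm{STS}(D,w) = \{\mathrm{supp}(v+w) : v \in D, d(v,w)=3\}$; $|x| = x_1+\dots+x_n \bmod 2$. (Assmus–Mattson construction) For a Steiner triple system $S$ on $\{1,\dots,n\}$ and $\theta : S\to\{0,1\}$, $S^\theta$ is the Steiner triple system on $\{1,\dots,2n+1\}$ consisting of: the triples $\{i, n+1, i+n+1\}$ for all $i\in\{1,\dots,n\}$; for each $\{i,j,k\}\in S$ with $\theta(\{i,j,k\})=0$, the triples $\{i,j,k\}$, $\{i, j+n+1, k+n+1\}$, $\{k, i+n+1, j+n+1\}$, $\{j, i+n+1, k+n+1\}$; for each $\{i,j,k\}\in S$ with $\theta(\{i,j,k\})=1$, the triples $\{i+n+1, j+n+1, k+n+1\}$, $\{i,j,k+n+1\}$, $\{j,k,i+n+1\}$, $\{i,k,j+n+1\}$. -}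

module Defs where

open import Data.Nat using (ℕ; zero; suc; _+_; _^_)
open import Data.Bool using (Bool; true; false; _xor_)
open import Data.Vec using (Vec; []; _∷_; _++_; zipWith; replicate; foldr)
open import Data.Fin using (Fin; zero; suc; _↑ˡ_; _↑ʳ_)
open import Data.Fin.Subset using (Subset; ⁅_⁆; _∪_; ∣_∣)
open import Data.Product using (Σ; _×_; _,_; ∃; ∃-syntax)
open import Data.Sum using (_⊎_)
open import Relation.Binary.PropositionalEquality using (_≡_)

-- Binary words of length n (F = GF(2) represented by Bool, + is xor).
Word : ℕ → Set
Word n = Vec Bool n

_⊕_ : ∀ {n} → Word n → Word n → Word n
_⊕_ = zipWith _xor_

zeroWord : ∀ n → Word n
zeroWord n = replicate n false

supp : ∀ {n} → Word n → Subset n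
supp w = w

dist : ∀ {n} → Word n → Word n → ℕ
dist v w = ∣ supp (v ⊕ w) ∣

-- |x| = x_1 + ... + x_n mod 2
parity : ∀ {n} → Word n → Bool
parity = foldr _ _xor_ false

Code : ℕ → Set
Code n = Word n → Bool

_∈C_ : ∀ {n} → Word n → Code n → Set
w ∈C C = C w ≡ true

data _≤1 : ℕ → Set where
  d0 : zero ≤1
  d1 : suc zero ≤1

IsPerfect : ∀ {n} → Code n → Set
IsPerfect {n} C =
  (w : Word n) →
    (Σ (Word n) λ c → c ∈C C × dist w c ≤1) ×
    (∀ c c' → c ∈C C → c' ∈C C → dist w c ≤1 → dist w c' ≤1 → c ≡ c')

STS : ∀ {m} → (Word m → Set) → Word m → Subset m → Set
STS {m} D w T = Σ (Word m) λ v → D v × dist v w ≡ 3 × supp (v ⊕ w) ≡ T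

-- the code V_C^λ of length n + 1 + n:
-- coordinates 0..n-1 : x + y, coordinate n : |x| + λ(y), coordinates n+1..2n : x
V : ∀ {n} → Code n → (Word n → Bool) → Word (n + suc n) → Set
V {n} C lam w =
  Σ (Word n) λ x → Σ (Word n) λ y → y ∈C C × w ≡ ((x ⊕ y) ++ ((parity x xor lam y) ∷ x))

tri : ∀ {m} → Fin m → Fin m → Fin m → Subset m
tri a b c = ⁅ a ⁆ ∪ (⁅ b ⁆ ∪ ⁅ c ⁆)

-- coordinate embeddings into Fin (n + suc n) (0-based):
-- paper's i ↦ L i, paper's n+1 ↦ M, paper's i+n+1 ↦ R i
L : ∀ {n} → Fin n → Fin (n + suc n)
L {n} i = i ↑ˡ suc n

M : ∀ {n} → Fin (n + suc n)
M {n} = n ↑ʳ zero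

R : ∀ {n} → Fin n → Fin (n + suc n)
R {n} i = n ↑ʳ suc i

AM : ∀ {n} (S : Subset n → Set) → ((T : Subset n) → S T → Bool) → Subset (n + suc n) → Set
AM {n} S θ T =
  (Σ (Fin n) λ i → T ≡ tri (L i) M (R i))
  ⊎ (Σ (Fin n) λ i → Σ (Fin n) λ j → Σ (Fin n) λ k → Σ (S (tri i j k)) λ s →
       θ (tri i j k) s ≡ false ×
       (T ≡ tri (L i) (L j) (L k) ⊎ T ≡ tri (L i) (R j) (R k)
        ⊎ T ≡ tri (L k) (R i) (R j) ⊎ T ≡ tri (L j) (R i) (R k)))
  ⊎ (Σ (Fin n) λ i → Σ (Fin n) λ j → Σ (Fin n) λ k → Σ (S (tri i j k)) λ s →
       θ (tri i j k) s ≡ true ×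
       (T ≡ tri (R i) (R j) (R k) ⊎ T ≡ tri (L i) (L j) (R k)
        ⊎ T ≡ tri (L j) (L k) (R i) ⊎ T ≡ tri (L i) (L k) (R j)))

θC : ∀ {n} (C : Code n) (lam : Word n → Bool) (y : Word n) →
     (T : Subset n) → STS (λ v → v ∈C C) y T → Bool
θC C lam y T (y' , _ , _ , _) = lam y xor lam y'

-- Every codeword (x' + y', |x'| + λ(y'), x') of V_C^λ differs from z by the
-- "offset" (a + b, |a| + λ(y'), a), where a = x' + x is arbitrary and b = y' + y;
-- so the blocks of STS(V_C^λ, z) are the offsets of weight 3.  By
-- inclusion–exclusion such a weight is [|a| + λ(y')] + |b| + 2|a ∖ b|.  If y' = y
-- (then λ(y) = 0 since z ∈ V_C^λ) weight 3 forces a = {i}: the offset is the axis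
-- triple {i, n+1, i+n+1}.  If y' ≠ y, then |b| ≥ 3 because a perfect code has
-- minimum distance 3, so weight 3 forces |b| = 3, a ⊆ b and |a| = λ(y'): supp b is
-- a triple {i, j, k} of STS(C, y) with θ-value λ(y') = |a|, and the offset is its
-- "lift" putting the coordinates in a into the right block and the others into the
-- left one.  Conversely every such lift is an offset of weight 3.  Finally the eight
-- triples in the definition of S^θ are, up to order, exactly the lifts whose side
-- pattern has parity θ.

module Submission where

open import Defs
open import Data.Nat using (ℕ; zero; suc; _+_; _^_; _≤_; s≤s; z≤n)
open import Data.Nat.Properties using (+-commutativeSemigroup; +-suc; suc-injective; ≤-trans; ≤-reflexive; +-monoʳ-≤; n≤1+n; m≤n+m; m+n≡0⇒m≡0; m+n≡0⇒n≡0)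
open import Data.Bool using (Bool; true; false; _xor_; _∨_; not)
open import Data.Bool.Properties using (xor-assoc; xor-comm; xor-identityˡ; xor-identityʳ; xor-same; xor-∧-commutativeRing)
import Data.Bool.Properties as Bool
open import Data.Vec using ([]; _∷_; _++_; zipWith; lookup; here; there)
open import Data.Vec.Properties using (zipWith-assoc; zipWith-comm; zipWith-identityˡ; zipWith-identityʳ; zipWith-++; ++-injective; ∷-injective; ≡-dec)
open import Data.Fin using (Fin; zero; suc; _↑ˡ_; _↑ʳ_)
open import Data.Fin.Subset using (Subset; ⁅_⁆; _∪_; _∩_; _─_; _∈_; ∣_∣) renaming (⊥ to ∅)
open import Data.Fin.Subset.Properties using (∪-identityˡ; ∪-identityʳ; ∪-assoc; ∪-idem; ∪-commutativeMonoid; ∩-zeroˡ; ∩-zeroʳ; ∩-distribˡ-∪; ∣⁅x⁆∣≡1; ∣⊥∣≡0; x∈⁅x⁆; x∈p∪q⁺)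
open import Data.Product using (Σ; _×_; _,_; proj₁; proj₂)
open import Data.Sum using (_⊎_; inj₁; inj₂)
open import Data.Empty using (⊥)
open import Relation.Nullary using (¬_; yes; no; contradiction)
open import Relation.Binary.PropositionalEquality
open import Function.Bundles using (_⇔_; mk⇔)
open import Function.Properties.Equivalence using () renaming (trans to ⇔-trans; sym to ⇔-sym)
open import Algebra.Bundles using (CommutativeMonoid; CommutativeRing)
open import Algebra.Structures using (IsCommutativeMonoid)
import Algebra.Properties.CommutativeSemigroup as CSProps

-- Words under ⊕ form a commutative monoid (indeed an elementary abelian 2-group);
-- the library's rearrangement lemmas for commutative semigroups then apply to
-- words, to subsets under ∪, and to bits under xor.
⊕-isCommutativeMonoid : ∀ n → IsCommutativeMonoid _≡_ (_⊕_ {n}) (zeroWord n)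
⊕-isCommutativeMonoid n = record
  { isMonoid = record
    { isSemigroup = record
      { isMagma = record { isEquivalence = isEquivalence ; ∙-cong = cong₂ _⊕_ }
      ; assoc = zipWith-assoc xor-assoc }
    ; identity = zipWith-identityˡ xor-identityˡ , zipWith-identityʳ xor-identityʳ }
  ; comm = zipWith-comm xor-comm }

⊕-commutativeMonoid : ℕ → CommutativeMonoid _ _
⊕-commutativeMonoid n = record { isCommutativeMonoid = ⊕-isCommutativeMonoid n }

module ⊕-Props {n : ℕ} = CSProps (CommutativeMonoid.commutativeSemigroup (⊕-commutativeMonoid n))
module ∪-Props {n : ℕ} = CSProps (CommutativeMonoid.commutativeSemigroup (∪-commutativeMonoid n))
module xor-Props = CSProps (CommutativeRing.+-commutativeSemigroup xor-∧-commutativeRing)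

module _ {n : ℕ} where
  open IsCommutativeMonoid (⊕-isCommutativeMonoid n) public
    using () renaming (assoc to ⊕-assoc; comm to ⊕-comm; identityˡ to ⊕-identityˡ; identityʳ to ⊕-identityʳ)

⊕-self : ∀ {n} (p : Word n) → p ⊕ p ≡ ∅
⊕-self [] = refl
⊕-self (c ∷ p) = cong₂ _∷_ (xor-same c) (⊕-self p)

⊕-cancelʳ : ∀ {n} (p q : Word n) → (p ⊕ q) ⊕ q ≡ p
⊕-cancelʳ p q = begin
  (p ⊕ q) ⊕ q  ≡⟨ ⊕-assoc p q q ⟩
  p ⊕ (q ⊕ q)  ≡⟨ cong (p ⊕_) (⊕-self q) ⟩
  p ⊕ ∅        ≡⟨ ⊕-identityʳ p ⟩
  p            ∎
  where open ≡-Reasoning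

⊕-injectiveʳ : ∀ {n} (p : Word n) {q q'} → p ⊕ q ≡ p ⊕ q' → q ≡ q'
⊕-injectiveʳ p {q} {q'} e = begin
  q            ≡⟨ sym (⊕-cancelʳ q p) ⟩
  (q ⊕ p) ⊕ p  ≡⟨ cong (_⊕ p) (trans (⊕-comm q p) (trans e (⊕-comm p q'))) ⟩
  (q' ⊕ p) ⊕ p ≡⟨ ⊕-cancelʳ q' p ⟩
  q'           ∎
  where open ≡-Reasoning

⊕≡∅⇒≡ : ∀ {n} (p q : Word n) → p ⊕ q ≡ ∅ → p ≡ q
⊕≡∅⇒≡ p q e = begin
  p            ≡⟨ sym (⊕-cancelʳ p q) ⟩
  (p ⊕ q) ⊕ q  ≡⟨ cong (_⊕ q) e ⟩
  ∅ ⊕ q        ≡⟨ ⊕-identityˡ q ⟩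
  q            ∎
  where open ≡-Reasoning

parity-⊕ : ∀ {n} (p q : Word n) → parity (p ⊕ q) ≡ parity p xor parity q
parity-⊕ [] [] = refl
parity-⊕ (c ∷ p) (d ∷ q) = begin
  (c xor d) xor parity (p ⊕ q)          ≡⟨ cong ((c xor d) xor_) (parity-⊕ p q) ⟩
  (c xor d) xor (parity p xor parity q) ≡⟨ xor-Props.interchange c d (parity p) (parity q) ⟩
  (c xor parity p) xor (d xor parity q) ∎
  where open ≡-Reasoning

parity-∅ : ∀ n → parity (∅ {n}) ≡ false
parity-∅ zero = refl
parity-∅ (suc n) = parity-∅ n

parity-⁅⁆ : ∀ {n} (i : Fin n) → parity ⁅ i ⁆ ≡ true
parity-⁅⁆ {suc n} zero = cong (true xor_) (parity-∅ n)
parity-⁅⁆ (suc i) = parity-⁅⁆ i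

bit : Bool → ℕ
bit true = 1
bit false = 0

∣c∷p∣ : ∀ {n} c (p : Subset n) → ∣ c ∷ p ∣ ≡ bit c + ∣ p ∣
∣c∷p∣ true p = refl
∣c∷p∣ false p = refl

∣p++q∣ : ∀ {m n} (p : Subset m) (q : Subset n) → ∣ p ++ q ∣ ≡ ∣ p ∣ + ∣ q ∣
∣p++q∣ [] q = refl
∣p++q∣ (true ∷ p) q = cong suc (∣p++q∣ p q)
∣p++q∣ (false ∷ p) q = ∣p++q∣ p q

∣p∣≡0⇒p≡∅ : ∀ {n} (p : Subset n) → ∣ p ∣ ≡ 0 → p ≡ ∅
∣p∣≡0⇒p≡∅ [] _ = refl
∣p∣≡0⇒p≡∅ (false ∷ p) e = cong (false ∷_) (∣p∣≡0⇒p≡∅ p e)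

∣p∪q∣≤∣p∣+∣q∣ : ∀ {n} (p q : Subset n) → ∣ p ∪ q ∣ ≤ ∣ p ∣ + ∣ q ∣
∣p∪q∣≤∣p∣+∣q∣ [] [] = z≤n
∣p∪q∣≤∣p∣+∣q∣ (true ∷ p) (true ∷ q) = s≤s (≤-trans (∣p∪q∣≤∣p∣+∣q∣ p q) (+-monoʳ-≤ ∣ p ∣ (n≤1+n ∣ q ∣)))
∣p∪q∣≤∣p∣+∣q∣ (true ∷ p) (false ∷ q) = s≤s (∣p∪q∣≤∣p∣+∣q∣ p q)
∣p∪q∣≤∣p∣+∣q∣ (false ∷ p) (true ∷ q) = ≤-trans (s≤s (∣p∪q∣≤∣p∣+∣q∣ p q)) (≤-reflexive (sym (+-suc ∣ p ∣ ∣ q ∣)))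
∣p∪q∣≤∣p∣+∣q∣ (false ∷ p) (false ∷ q) = ∣p∪q∣≤∣p∣+∣q∣ p q

∣p⊕q∣+∣p∣ : ∀ {n} (p q : Word n) → ∣ p ⊕ q ∣ + ∣ p ∣ ≡ ∣ q ∣ + (∣ p ─ q ∣ + ∣ p ─ q ∣)
∣p⊕q∣+∣p∣ [] [] = refl
∣p⊕q∣+∣p∣ (true ∷ p) (true ∷ q) = trans (+-suc ∣ p ⊕ q ∣ ∣ p ∣) (cong suc (∣p⊕q∣+∣p∣ p q))
∣p⊕q∣+∣p∣ (true ∷ p) (false ∷ q) = begin
  suc (∣ p ⊕ q ∣ + suc ∣ p ∣)   ≡⟨ cong suc (+-suc ∣ p ⊕ q ∣ ∣ p ∣) ⟩
  suc (suc (∣ p ⊕ q ∣ + ∣ p ∣)) ≡⟨ cong (λ m → suc (suc m)) (∣p⊕q∣+∣p∣ p q) ⟩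
  suc (suc (∣ q ∣ + (d + d)))   ≡⟨ cong suc (sym (+-suc ∣ q ∣ (d + d))) ⟩
  suc (∣ q ∣ + suc (d + d))     ≡⟨ sym (+-suc ∣ q ∣ (suc (d + d))) ⟩
  ∣ q ∣ + suc (suc (d + d))     ≡⟨ cong (λ m → ∣ q ∣ + suc m) (sym (+-suc d d)) ⟩
  ∣ q ∣ + (suc d + suc d)       ∎
  where
  open ≡-Reasoning
  d : ℕ
  d = ∣ p ─ q ∣
∣p⊕q∣+∣p∣ (false ∷ p) (true ∷ q) = cong suc (∣p⊕q∣+∣p∣ p q)
∣p⊕q∣+∣p∣ (false ∷ p) (false ∷ q) = ∣p⊕q∣+∣p∣ p q

∣p∣≡1⇒singleton : ∀ {n} (p : Subset n) → ∣ p ∣ ≡ 1 → Σ (Fin n) λ i → p ≡ ⁅ i ⁆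
∣p∣≡1⇒singleton (true ∷ p) e = zero , cong (true ∷_) (∣p∣≡0⇒p≡∅ p (suc-injective e))
∣p∣≡1⇒singleton (false ∷ p) e with ∣p∣≡1⇒singleton p e
... | i , p≡⁅i⁆ = suc i , cong (false ∷_) p≡⁅i⁆

∣p∣≡2⇒pair : ∀ {n} (p : Subset n) → ∣ p ∣ ≡ 2 → Σ (Fin n) λ i → Σ (Fin n) λ j → p ≡ ⁅ i ⁆ ∪ ⁅ j ⁆
∣p∣≡2⇒pair (true ∷ p) e with ∣p∣≡1⇒singleton p (suc-injective e)
... | j , p≡⁅j⁆ = zero , suc j , cong (true ∷_) (trans p≡⁅j⁆ (sym (∪-identityˡ ⁅ j ⁆)))
∣p∣≡2⇒pair (false ∷ p) e with ∣p∣≡2⇒pair p e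
... | i , j , p≡ = suc i , suc j , cong (false ∷_) p≡

∣p∣≡3⇒triple : ∀ {n} (p : Subset n) → ∣ p ∣ ≡ 3 →
               Σ (Fin n) λ i → Σ (Fin n) λ j → Σ (Fin n) λ k → p ≡ tri i j k
∣p∣≡3⇒triple (true ∷ p) e with ∣p∣≡2⇒pair p (suc-injective e)
... | j , k , p≡ = zero , suc j , suc k , cong (true ∷_) (trans p≡ (sym (∪-identityˡ _)))
∣p∣≡3⇒triple (false ∷ p) e with ∣p∣≡3⇒triple p e
... | i , j , k , p≡ = suc i , suc j , suc k , cong (false ∷_) p≡

flip-one : ∀ {m n} (p : Word n) → ∣ p ∣ ≡ suc m → Σ (Fin n) λ i → ∣ p ⊕ ⁅ i ⁆ ∣ ≡ m
flip-one (true ∷ p) e = zero , trans (cong ∣_∣ (⊕-identityʳ p)) (suc-injective e)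
flip-one (false ∷ p) e with flip-one p e
... | i , e' = suc i , e'

Distinct : ∀ {n} → Fin n → Fin n → Fin n → Set
Distinct i j k = ¬ i ≡ j × ¬ i ≡ k × ¬ j ≡ k

triple-distinct : ∀ {n} (i j k : Fin n) → ∣ tri i j k ∣ ≡ 3 → Distinct i j k
triple-distinct i j k w3 = (λ { refl → pair-bound i k absorb₁ }) , (λ { refl → pair-bound j i absorb₂ }) ,
                           (λ { refl → pair-bound i j (cong (⁅ i ⁆ ∪_) (∪-idem ⁅ j ⁆)) })
  where
  -- a triple with a repeated index is a pair, hence has weight at most 2
  pair-bound : ∀ a b → tri i j k ≡ ⁅ a ⁆ ∪ ⁅ b ⁆ → ⊥
  pair-bound a b e with ≤-trans (≤-reflexive (trans (sym w3) (cong ∣_∣ e)))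
                                (≤-trans (∣p∪q∣≤∣p∣+∣q∣ ⁅ a ⁆ ⁅ b ⁆) (≤-reflexive (cong₂ _+_ (∣⁅x⁆∣≡1 a) (∣⁅x⁆∣≡1 b))))
  ... | s≤s (s≤s ())
  absorb₁ : tri i i k ≡ ⁅ i ⁆ ∪ ⁅ k ⁆
  absorb₁ = trans (sym (∪-assoc ⁅ i ⁆ ⁅ i ⁆ ⁅ k ⁆)) (cong (_∪ ⁅ k ⁆) (∪-idem ⁅ i ⁆))
  absorb₂ : tri i j i ≡ ⁅ j ⁆ ∪ ⁅ i ⁆
  absorb₂ = trans (∪-Props.x∙yz≈y∙xz ⁅ i ⁆ ⁅ j ⁆ ⁅ i ⁆) (cong (⁅ j ⁆ ∪_) (∪-idem ⁅ i ⁆))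

-- Distinct codewords of a perfect code are at distance at least 3: a word at
-- distance ≤ 1 from both would contradict the uniqueness of its nearest codeword.
perfect-min-distance : ∀ {n} (C : Code n) → IsPerfect C → ∀ {c c'} → c ∈C C → c' ∈C C →
                       ¬ c ≡ c' → 3 ≤ dist c c'
perfect-min-distance {n} C perf {c} {c'} c∈C c'∈C c≢c' = bound (dist c c') refl
  where
  nearest-unique : (w : Word n) → dist w c ≤1 → dist w c' ≤1 → c ≡ c'
  nearest-unique w = proj₂ (perf w) c c' c∈C c'∈C

  bound : ∀ d → dist c c' ≡ d → 3 ≤ d
  bound zero d≡ = contradiction (⊕≡∅⇒≡ c c' (∣p∣≡0⇒p≡∅ (c ⊕ c') d≡)) c≢c'
  bound (suc zero) d≡ = contradiction (nearest-unique c (subst _≤1 (sym dcc) d0) (subst _≤1 (sym d≡) d1)) c≢c'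
    where
    dcc : dist c c ≡ 0
    dcc = trans (cong ∣_∣ (⊕-self c)) (∣⊥∣≡0 n)
  -- flip one of the two differing coordinates of c to get a word between c and c'
  bound (suc (suc zero)) d≡ with flip-one (c ⊕ c') d≡
  ... | i , d₂ = contradiction (nearest-unique (c ⊕ ⁅ i ⁆) (subst _≤1 (sym d₁') d1) (subst _≤1 (sym d₂') d1)) c≢c'
    where
    d₁' : dist (c ⊕ ⁅ i ⁆) c ≡ 1
    d₁' = trans (cong ∣_∣ (trans (⊕-Props.xy∙z≈y∙xz c ⁅ i ⁆ c) (trans (cong (⁅ i ⁆ ⊕_) (⊕-self c)) (⊕-identityʳ ⁅ i ⁆)))) (∣⁅x⁆∣≡1 i)
    d₂' : dist (c ⊕ ⁅ i ⁆) c' ≡ 1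
    d₂' = trans (cong ∣_∣ (⊕-Props.xy∙z≈xz∙y c ⁅ i ⁆ c')) d₂
  bound (suc (suc (suc _))) _ = s≤s (s≤s (s≤s z≤n))

sel : ∀ {n} → Bool → Fin n → Subset n
sel true i = ⁅ i ⁆
sel false i = ∅

sub : ∀ {n} → Fin n → Fin n → Fin n → Bool → Bool → Bool → Subset n
sub i j k α β γ = sel α i ∪ (sel β j ∪ sel γ k)

sel-flip : ∀ {n} α (i : Fin n) → sel α i ⊕ ⁅ i ⁆ ≡ sel (not α) i
sel-flip true i = ⊕-self ⁅ i ⁆
sel-flip false i = ⊕-identityˡ ⁅ i ⁆

parity-sel : ∀ {n} α (i : Fin n) → parity (sel α i) ≡ α
parity-sel true i = parity-⁅⁆ i
parity-sel {n} false i = parity-∅ n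

disjoint-∪ : ∀ {n} (p q : Subset n) → p ∩ q ≡ ∅ → p ∪ q ≡ p ⊕ q
disjoint-∪ [] [] _ = refl
disjoint-∪ (true ∷ p) (true ∷ q) ()
disjoint-∪ (true ∷ p) (false ∷ q) e = cong (true ∷_) (disjoint-∪ p q (proj₂ (∷-injective e)))
disjoint-∪ (false ∷ p) (c ∷ q) e = cong (c ∷_) (disjoint-∪ p q (proj₂ (∷-injective e)))

⁅⁆-disjoint : ∀ {n} (i j : Fin n) → ¬ i ≡ j → ⁅ i ⁆ ∩ ⁅ j ⁆ ≡ ∅
⁅⁆-disjoint zero zero i≢j = contradiction refl i≢j
⁅⁆-disjoint zero (suc j) _ = cong (false ∷_) (∩-zeroˡ ⁅ j ⁆)
⁅⁆-disjoint (suc i) zero _ = cong (false ∷_) (∩-zeroʳ ⁅ i ⁆)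
⁅⁆-disjoint (suc i) (suc j) i≢j = cong (false ∷_) (⁅⁆-disjoint i j (λ e → i≢j (cong suc e)))

sel-disjoint : ∀ {n} α β {i j : Fin n} → ¬ i ≡ j → sel α i ∩ sel β j ≡ ∅
sel-disjoint true true {i} {j} i≢j = ⁅⁆-disjoint i j i≢j
sel-disjoint true false {i} _ = ∩-zeroʳ ⁅ i ⁆
sel-disjoint false β {j = j} _ = ∩-zeroˡ (sel β j)

sub-as-⊕ : ∀ {n} {i j k : Fin n} → Distinct i j k → ∀ α β γ →
           sub i j k α β γ ≡ sel α i ⊕ (sel β j ⊕ sel γ k)
sub-as-⊕ {i = i} {j} {k} (i≢j , i≢k , j≢k) α β γ = begin
  sel α i ∪ (sel β j ∪ sel γ k) ≡⟨ disjoint-∪ (sel α i) _ outer-disjoint ⟩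
  sel α i ⊕ (sel β j ∪ sel γ k) ≡⟨ cong (sel α i ⊕_) (disjoint-∪ (sel β j) (sel γ k) (sel-disjoint β γ j≢k)) ⟩
  sel α i ⊕ (sel β j ⊕ sel γ k) ∎
  where
  open ≡-Reasoning
  outer-disjoint : sel α i ∩ (sel β j ∪ sel γ k) ≡ ∅
  outer-disjoint = trans (∩-distribˡ-∪ (sel α i) (sel β j) (sel γ k))
                         (trans (cong₂ _∪_ (sel-disjoint α β i≢j) (sel-disjoint α γ i≢k)) (∪-identityˡ ∅))

sub-⊕-tri : ∀ {n} {i j k : Fin n} → Distinct i j k → ∀ α β γ →
            sub i j k α β γ ⊕ tri i j k ≡ sub i j k (not α) (not β) (not γ)
sub-⊕-tri {i = i} {j} {k} dist α β γ = begin
  sub i j k α β γ ⊕ tri i j k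
    ≡⟨ cong₂ _⊕_ (sub-as-⊕ dist α β γ) (sub-as-⊕ dist true true true) ⟩
  (sel α i ⊕ (sel β j ⊕ sel γ k)) ⊕ (⁅ i ⁆ ⊕ (⁅ j ⁆ ⊕ ⁅ k ⁆))
    ≡⟨ ⊕-Props.interchange (sel α i) _ ⁅ i ⁆ _ ⟩
  (sel α i ⊕ ⁅ i ⁆) ⊕ ((sel β j ⊕ sel γ k) ⊕ (⁅ j ⁆ ⊕ ⁅ k ⁆))
    ≡⟨ cong ((sel α i ⊕ ⁅ i ⁆) ⊕_) (⊕-Props.interchange (sel β j) (sel γ k) ⁅ j ⁆ ⁅ k ⁆) ⟩
  (sel α i ⊕ ⁅ i ⁆) ⊕ ((sel β j ⊕ ⁅ j ⁆) ⊕ (sel γ k ⊕ ⁅ k ⁆))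
    ≡⟨ cong₂ _⊕_ (sel-flip α i) (cong₂ _⊕_ (sel-flip β j) (sel-flip γ k)) ⟩
  sel (not α) i ⊕ (sel (not β) j ⊕ sel (not γ) k)
    ≡⟨ sym (sub-as-⊕ dist (not α) (not β) (not γ)) ⟩
  sub i j k (not α) (not β) (not γ) ∎
  where open ≡-Reasoning

parity-sub : ∀ {n} {i j k : Fin n} → Distinct i j k → ∀ α β γ →
             parity (sub i j k α β γ) ≡ α xor (β xor γ)
parity-sub {i = i} {j} {k} dist α β γ = begin
  parity (sub i j k α β γ)                                  ≡⟨ cong parity (sub-as-⊕ dist α β γ) ⟩
  parity (sel α i ⊕ (sel β j ⊕ sel γ k))                    ≡⟨ parity-⊕ (sel α i) _ ⟩
  parity (sel α i) xor parity (sel β j ⊕ sel γ k)           ≡⟨ cong (parity (sel α i) xor_) (parity-⊕ (sel β j) (sel γ k)) ⟩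
  parity (sel α i) xor (parity (sel β j) xor parity (sel γ k))
    ≡⟨ cong₂ _xor_ (parity-sel α i) (cong₂ _xor_ (parity-sel β j) (parity-sel γ k)) ⟩
  α xor (β xor γ)                                           ∎
  where open ≡-Reasoning

∩-⁅⁆ : ∀ {n} (p : Subset n) (i : Fin n) → p ∩ ⁅ i ⁆ ≡ sel (lookup p i) i
∩-⁅⁆ (true ∷ p) zero = cong (true ∷_) (∩-zeroʳ p)
∩-⁅⁆ (false ∷ p) zero = cong (false ∷_) (∩-zeroʳ p)
∩-⁅⁆ (c ∷ p) (suc i) = trans (cong₂ _∷_ (Bool.∧-zeroʳ c) (∩-⁅⁆ p i)) (sel-suc (lookup p i))
  where
  sel-suc : ∀ α → false ∷ sel α i ≡ sel α (suc i)
  sel-suc true = refl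
  sel-suc false = refl

─≡∅⇒≡∩ : ∀ {n} (p q : Subset n) → p ─ q ≡ ∅ → p ≡ p ∩ q
─≡∅⇒≡∩ [] [] _ = refl
─≡∅⇒≡∩ (c ∷ p) (true ∷ q) e = cong₂ _∷_ (sym (Bool.∧-identityʳ c)) (─≡∅⇒≡∩ p q (proj₂ (∷-injective e)))
─≡∅⇒≡∩ (false ∷ p) (false ∷ q) e = cong (false ∷_) (─≡∅⇒≡∩ p q (proj₂ (∷-injective e)))

⊆tri⇒sub : ∀ {n} (p : Subset n) (i j k : Fin n) → p ─ tri i j k ≡ ∅ →
           p ≡ sub i j k (lookup p i) (lookup p j) (lookup p k)
⊆tri⇒sub p i j k p⊆ = begin
  p                                         ≡⟨ ─≡∅⇒≡∩ p (tri i j k) p⊆ ⟩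
  p ∩ (⁅ i ⁆ ∪ (⁅ j ⁆ ∪ ⁅ k ⁆))              ≡⟨ ∩-distribˡ-∪ p ⁅ i ⁆ _ ⟩
  p ∩ ⁅ i ⁆ ∪ p ∩ (⁅ j ⁆ ∪ ⁅ k ⁆)           ≡⟨ cong (p ∩ ⁅ i ⁆ ∪_) (∩-distribˡ-∪ p ⁅ j ⁆ ⁅ k ⁆) ⟩
  p ∩ ⁅ i ⁆ ∪ (p ∩ ⁅ j ⁆ ∪ p ∩ ⁅ k ⁆)       ≡⟨ cong₂ _∪_ (∩-⁅⁆ p i) (cong₂ _∪_ (∩-⁅⁆ p j) (∩-⁅⁆ p k)) ⟩
  sub i j k (lookup p i) (lookup p j) (lookup p k) ∎
  where open ≡-Reasoning

∅─p : ∀ {n} (p : Subset n) → ∅ ─ p ≡ ∅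
∅─p [] = refl
∅─p (true ∷ p) = cong (false ∷_) (∅─p p)
∅─p (false ∷ p) = cong (false ∷_) (∅─p p)

─-distribʳ-∪ : ∀ {n} (p q r : Subset n) → (p ∪ q) ─ r ≡ (p ─ r) ∪ (q ─ r)
─-distribʳ-∪ [] [] [] = refl
─-distribʳ-∪ (a ∷ p) (b ∷ q) (true ∷ r) = cong (false ∷_) (─-distribʳ-∪ p q r)
─-distribʳ-∪ (a ∷ p) (b ∷ q) (false ∷ r) = cong ((a ∨ b) ∷_) (─-distribʳ-∪ p q r)

sel─ : ∀ {n} α {x : Fin n} {p : Subset n} → x ∈ p → sel α x ─ p ≡ ∅
sel─ false {p = p} _ = ∅─p p
sel─ true x∈p = singleton─ x∈p
  where
  singleton─ : ∀ {n} {x : Fin n} {p : Subset n} → x ∈ p → ⁅ x ⁆ ─ p ≡ ∅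
  singleton─ {p = true ∷ p} here = cong (false ∷_) (∅─p p)
  singleton─ {p = true ∷ p} (there x∈p) = cong (false ∷_) (singleton─ x∈p)
  singleton─ {p = false ∷ p} (there x∈p) = cong (false ∷_) (singleton─ x∈p)

sub─tri : ∀ {n} (i j k : Fin n) α β γ → sub i j k α β γ ─ tri i j k ≡ ∅
sub─tri i j k α β γ = begin
  (sel α i ∪ (sel β j ∪ sel γ k)) ─ T              ≡⟨ ─-distribʳ-∪ (sel α i) _ T ⟩
  (sel α i ─ T) ∪ ((sel β j ∪ sel γ k) ─ T)        ≡⟨ cong ((sel α i ─ T) ∪_) (─-distribʳ-∪ (sel β j) (sel γ k) T) ⟩
  (sel α i ─ T) ∪ ((sel β j ─ T) ∪ (sel γ k ─ T))
    ≡⟨ cong₂ _∪_ (sel─ α (x∈p∪q⁺ (inj₁ (x∈⁅x⁆ i))))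
                 (cong₂ _∪_ (sel─ β (x∈p∪q⁺ (inj₂ (x∈p∪q⁺ (inj₁ (x∈⁅x⁆ j))))))
                            (sel─ γ (x∈p∪q⁺ (inj₂ (x∈p∪q⁺ (inj₂ (x∈⁅x⁆ k))))))) ⟩
  ∅ ∪ (∅ ∪ ∅)                                      ≡⟨ trans (∪-identityˡ _) (∪-identityˡ ∅) ⟩
  ∅                                                ∎
  where
  open ≡-Reasoning
  T : Subset _
  T = tri i j k

glue : ∀ {n} → Word n → Bool → Word n → Word (n + suc n)
glue u c w = u ++ (c ∷ w)

glue-zipWith : ∀ {n} (f : Bool → Bool → Bool) (u u' : Word n) c c' (w w' : Word n) →
               zipWith f (glue u c w) (glue u' c' w') ≡ glue (zipWith f u u') (f c c') (zipWith f w w')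
glue-zipWith f u u' c c' w w' = zipWith-++ f u (c ∷ w) u' (c' ∷ w')

∣glue∣ : ∀ {n} (u : Word n) c w → ∣ glue u c w ∣ ≡ ∣ u ∣ + (bit c + ∣ w ∣)
∣glue∣ u c w = trans (∣p++q∣ u (c ∷ w)) (cong (∣ u ∣ +_) (∣c∷p∣ c w))

glue-injective : ∀ {n} {u u' : Word n} {c c' w w'} → glue u c w ≡ glue u' c' w' → u ≡ u' × c ≡ c' × w ≡ w'
glue-injective {u = u} {u'} e with ++-injective u u' e
... | u≡u' , cw≡c'w' = u≡u' , ∷-injective cw≡c'w'

∅++∅ : ∀ m n → ∅ {m} ++ ∅ {n} ≡ ∅ {m + n}
∅++∅ zero n = refl
∅++∅ (suc m) n = cong (false ∷_) (∅++∅ m n)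

⁅↑ˡ⁆ : ∀ {m} n (i : Fin m) → ⁅ i ↑ˡ n ⁆ ≡ ⁅ i ⁆ ++ ∅ {n}
⁅↑ˡ⁆ {suc m} n zero = cong (true ∷_) (sym (∅++∅ m n))
⁅↑ˡ⁆ n (suc i) = cong (false ∷_) (⁅↑ˡ⁆ n i)

⁅↑ʳ⁆ : ∀ m {n} (j : Fin n) → ⁅ m ↑ʳ j ⁆ ≡ ∅ {m} ++ ⁅ j ⁆
⁅↑ʳ⁆ zero j = refl
⁅↑ʳ⁆ (suc m) j = cong (false ∷_) (⁅↑ʳ⁆ m j)

pt : ∀ {n} → Bool → Fin n → Fin (n + suc n)
pt false = L
pt true = R

⁅pt⁆ : ∀ {n} s (i : Fin n) → ⁅ pt s i ⁆ ≡ glue (sel (not s) i) false (sel s i)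
⁅pt⁆ {n} false i = ⁅↑ˡ⁆ (suc n) i
⁅pt⁆ {n} true i = ⁅↑ʳ⁆ n (suc i)

⁅M⁆ : ∀ {n} → ⁅ M {n} ⁆ ≡ glue ∅ true ∅
⁅M⁆ {n} = ⁅↑ʳ⁆ n zero

tri-glue : ∀ {n} {X Y Z : Fin (n + suc n)} {u₁ u₂ u₃ w₁ w₂ w₃ : Subset n} {c₁ c₂ c₃} →
           ⁅ X ⁆ ≡ glue u₁ c₁ w₁ → ⁅ Y ⁆ ≡ glue u₂ c₂ w₂ → ⁅ Z ⁆ ≡ glue u₃ c₃ w₃ →
           tri X Y Z ≡ glue (u₁ ∪ (u₂ ∪ u₃)) (c₁ ∨ (c₂ ∨ c₃)) (w₁ ∪ (w₂ ∪ w₃))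
tri-glue {u₁ = u₁} {u₂} {u₃} {w₁} {w₂} {w₃} {c₁} {c₂} {c₃} eX eY eZ = begin
  tri _ _ _
    ≡⟨ cong₂ _∪_ eX (cong₂ _∪_ eY eZ) ⟩
  glue u₁ c₁ w₁ ∪ (glue u₂ c₂ w₂ ∪ glue u₃ c₃ w₃)
    ≡⟨ cong (glue u₁ c₁ w₁ ∪_) (glue-zipWith _∨_ u₂ u₃ c₂ c₃ w₂ w₃) ⟩
  glue u₁ c₁ w₁ ∪ glue (u₂ ∪ u₃) (c₂ ∨ c₃) (w₂ ∪ w₃)
    ≡⟨ glue-zipWith _∨_ u₁ (u₂ ∪ u₃) c₁ (c₂ ∨ c₃) w₁ (w₂ ∪ w₃) ⟩
  glue (u₁ ∪ (u₂ ∪ u₃)) (c₁ ∨ (c₂ ∨ c₃)) (w₁ ∪ (w₂ ∪ w₃)) ∎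
  where open ≡-Reasoning

lift : ∀ {n} → Fin n → Fin n → Fin n → Bool → Bool → Bool → Subset (n + suc n)
lift i j k s t u = tri (pt s i) (pt t j) (pt u k)

lift-glue : ∀ {n} (i j k : Fin n) s t u →
            lift i j k s t u ≡ glue (sub i j k (not s) (not t) (not u)) false (sub i j k s t u)
lift-glue i j k s t u = tri-glue (⁅pt⁆ s i) (⁅pt⁆ t j) (⁅pt⁆ u k)

axis-glue : ∀ {n} (i : Fin n) → tri (L i) M (R i) ≡ glue ⁅ i ⁆ true ⁅ i ⁆
axis-glue i = trans (tri-glue (⁅pt⁆ false i) ⁅M⁆ (⁅pt⁆ true i))
                    (cong₂ (λ u w → glue u true w) (trans (cong (⁅ i ⁆ ∪_) (∪-identityˡ ∅)) (∪-identityʳ ⁅ i ⁆))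
                                                   (trans (∪-identityˡ _) (∪-identityˡ ⁅ i ⁆)))

axis-weight : ∀ {n} (i : Fin n) → ∣ tri (L i) M (R i) ∣ ≡ 3
axis-weight i = trans (cong ∣_∣ (axis-glue i))
                      (trans (∣glue∣ ⁅ i ⁆ true ⁅ i ⁆) (cong₂ (λ p q → p + suc q) (∣⁅x⁆∣≡1 i) (∣⁅x⁆∣≡1 i)))

-- The blocks of the Assmus–Mattson system S^θ come in two kinds: the axis triples
-- {i, n+1, i+n+1}, and the lifts of the triples of S to sides whose parity is θ.
-- (The eight explicit triples of the construction are these lifts up to order.)
Axis : ∀ {n} → Subset (n + suc n) → Set
Axis {n} T = Σ (Fin n) λ i → T ≡ tri (L i) M (R i)

Lifted : ∀ {n} (S : Subset n → Set) → ((T : Subset n) → S T → Bool) → Subset (n + suc n) → Set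
Lifted {n} S θ T = Σ (Fin n) λ i → Σ (Fin n) λ j → Σ (Fin n) λ k → Σ (S (tri i j k)) λ s →
                   Σ Bool λ a → Σ Bool λ b → Σ Bool λ c → θ (tri i j k) s ≡ a xor (b xor c) × T ≡ lift i j k a b c

module _ {n : ℕ} (S : Subset n → Set) (θ : (T : Subset n) → S T → Bool) where

  lift∈AM : ∀ i j k (s : S (tri i j k)) a b c → θ (tri i j k) s ≡ a xor (b xor c) → AM S θ (lift i j k a b c)
  lift∈AM i j k s false false false e = inj₂ (inj₁ (i , j , k , s , e , inj₁ refl))
  lift∈AM i j k s false true true e = inj₂ (inj₁ (i , j , k , s , e , inj₂ (inj₁ refl)))
  lift∈AM i j k s true true false e =
    inj₂ (inj₁ (i , j , k , s , e , inj₂ (inj₂ (inj₁ (∪-Props.x∙yz≈z∙xy _ _ _)))))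
  lift∈AM i j k s true false true e =
    inj₂ (inj₁ (i , j , k , s , e , inj₂ (inj₂ (inj₂ (∪-Props.x∙yz≈y∙xz _ _ _)))))
  lift∈AM i j k s true true true e = inj₂ (inj₂ (i , j , k , s , e , inj₁ refl))
  lift∈AM i j k s false false true e = inj₂ (inj₂ (i , j , k , s , e , inj₂ (inj₁ refl)))
  lift∈AM i j k s true false false e =
    inj₂ (inj₂ (i , j , k , s , e , inj₂ (inj₂ (inj₁ (∪-Props.x∙yz≈y∙zx _ _ _)))))
  lift∈AM i j k s false true false e =
    inj₂ (inj₂ (i , j , k , s , e , inj₂ (inj₂ (inj₂ (∪-Props.x∙yz≈x∙zy _ _ _)))))

  AM⇔Axis⊎Lifted : ∀ T → AM S θ T ⇔ (Axis T ⊎ Lifted S θ T)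
  AM⇔Axis⊎Lifted T = mk⇔ to from
    where
    to : AM S θ T → Axis T ⊎ Lifted S θ T
    to (inj₁ axis) = inj₁ axis
    to (inj₂ (inj₁ (i , j , k , s , e , inj₁ eT))) = inj₂ (i , j , k , s , false , false , false , e , eT)
    to (inj₂ (inj₁ (i , j , k , s , e , inj₂ (inj₁ eT)))) = inj₂ (i , j , k , s , false , true , true , e , eT)
    to (inj₂ (inj₁ (i , j , k , s , e , inj₂ (inj₂ (inj₁ eT))))) =
      inj₂ (i , j , k , s , true , true , false , e , trans eT (∪-Props.x∙yz≈y∙zx _ _ _))
    to (inj₂ (inj₁ (i , j , k , s , e , inj₂ (inj₂ (inj₂ eT))))) =
      inj₂ (i , j , k , s , true , false , true , e , trans eT (∪-Props.x∙yz≈y∙xz _ _ _))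
    to (inj₂ (inj₂ (i , j , k , s , e , inj₁ eT))) = inj₂ (i , j , k , s , true , true , true , e , eT)
    to (inj₂ (inj₂ (i , j , k , s , e , inj₂ (inj₁ eT)))) = inj₂ (i , j , k , s , false , false , true , e , eT)
    to (inj₂ (inj₂ (i , j , k , s , e , inj₂ (inj₂ (inj₁ eT))))) =
      inj₂ (i , j , k , s , true , false , false , e , trans eT (∪-Props.x∙yz≈z∙xy _ _ _))
    to (inj₂ (inj₂ (i , j , k , s , e , inj₂ (inj₂ (inj₂ eT))))) =
      inj₂ (i , j , k , s , false , true , false , e , trans eT (∪-Props.x∙yz≈x∙zy _ _ _))

    from : Axis T ⊎ Lifted S θ T → AM S θ T
    from (inj₁ axis) = inj₁ axis
    from (inj₂ (i , j , k , s , a , b , c , e , refl)) = lift∈AM i j k s a b c e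

-- Weight of a word glue (a + b) c a, the shape of every difference of two codewords
-- of V_C^λ (here b is the difference of the C-components and a ∖ b is written a ─ b).
∣glue-sum∣ : ∀ {n} (a b : Word n) c → ∣ glue (a ⊕ b) c a ∣ ≡ bit c + (∣ b ∣ + (∣ a ─ b ∣ + ∣ a ─ b ∣))
∣glue-sum∣ a b c = begin
  ∣ glue (a ⊕ b) c a ∣           ≡⟨ ∣glue∣ (a ⊕ b) c a ⟩
  ∣ a ⊕ b ∣ + (bit c + ∣ a ∣)    ≡⟨ CSProps.x∙yz≈y∙xz +-commutativeSemigroup (∣ a ⊕ b ∣) (bit c) (∣ a ∣) ⟩
  bit c + (∣ a ⊕ b ∣ + ∣ a ∣)    ≡⟨ cong (bit c +_) (∣p⊕q∣+∣p∣ a b) ⟩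
  bit c + (∣ b ∣ + (∣ a ─ b ∣ + ∣ a ─ b ∣)) ∎
  where open ≡-Reasoning

A+c+A≡3⇒A≡1 : ∀ A c → A + (bit c + A) ≡ 3 → A ≡ 1
A+c+A≡3⇒A≡1 zero true ()
A+c+A≡3⇒A≡1 zero false ()
A+c+A≡3⇒A≡1 (suc zero) c _ = refl
A+c+A≡3⇒A≡1 (suc (suc A)) c e = contradiction (subst (2 ≤_) (suc-injective (suc-injective e)) two≤) λ { (s≤s ()) }
  where
  two≤ : 2 ≤ A + (bit c + suc (suc A))
  two≤ = ≤-trans (s≤s (s≤s z≤n)) (≤-trans (m≤n+m (suc (suc A)) (bit c)) (m≤n+m _ A))

c+B+2d≡3 : ∀ c B d → bit c + (B + (d + d)) ≡ 3 → 3 ≤ B → c ≡ false × B ≡ 3 × d ≡ 0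
c+B+2d≡3 c zero d _ ()
c+B+2d≡3 c (suc zero) d _ (s≤s ())
c+B+2d≡3 c (suc (suc zero)) d _ (s≤s (s≤s ()))
c+B+2d≡3 true (suc (suc (suc B))) d () _
c+B+2d≡3 false (suc (suc (suc B))) d e _ =
  refl , cong (λ m → suc (suc (suc m))) (m+n≡0⇒m≡0 B rest) , m+n≡0⇒m≡0 d (m+n≡0⇒n≡0 B rest)
  where
  rest : B + (d + d) ≡ 0
  rest = suc-injective (suc-injective (suc-injective e))

xor≡false⇒≡ : ∀ p q → p xor q ≡ false → q ≡ p
xor≡false⇒≡ true true _ = refl
xor≡false⇒≡ false false _ = refl

≡xor⇒≡false : ∀ p q → p ≡ p xor q → q ≡ false
≡xor⇒≡false true false _ = refl
≡xor⇒≡false false false _ = refl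

-- If (x + y, |x|, x) is a codeword of V_C^λ with y ∈ C, then λ(y) = 0: the
-- representation (x + y, |x| + λ(y), x) of a codeword determines x and y.
glue-in-V⇒λ≡0 : ∀ {n} {C : Code n} {lam : Word n → Bool} {x y : Word n} →
                 V C lam (glue (x ⊕ y) (parity x) x) → lam y ≡ false
glue-in-V⇒λ≡0 {x = x} (x₀ , y₀ , _ , e) with glue-injective e
... | x⊕y≡x⊕y₀ , parity≡ , refl with ⊕-injectiveʳ x x⊕y≡x⊕y₀
...   | refl = ≡xor⇒≡false (parity x) _ parity≡

module Derivation {n : ℕ} (C : Code n) (perf : IsPerfect C) (lam : Word n → Bool)
                  (x y : Word n) (y∈C : y ∈C C) (λy≡0 : lam y ≡ false) where

  S : Subset n → Set
  S = STS (λ v → v ∈C C) y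

  θ : (T : Subset n) → S T → Bool
  θ = θC C lam y

  θ-value : ∀ {T} (s : S T) → θ T s ≡ lam (proj₁ s)
  θ-value (y' , _) = cong (_xor lam y') λy≡0

  z : Word (n + suc n)
  z = glue (x ⊕ y) (parity x) x

  codeword : Word n → Word n → Word (n + suc n)
  codeword x' y' = glue (x' ⊕ y') (parity x' xor lam y') x'

  -- The difference between z and a codeword of V_C^λ, parametrised by a = x' + x and y'.
  offset : Word n → Word n → Word (n + suc n)
  offset a y' = glue (a ⊕ (y' ⊕ y)) (parity a xor lam y') a

  codeword-offset : ∀ x' y' → codeword x' y' ⊕ z ≡ offset (x' ⊕ x) y'
  codeword-offset x' y' =
    trans (glue-zipWith _xor_ (x' ⊕ y') (x ⊕ y) (parity x' xor lam y') (parity x) x' x)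
          (cong₂ (λ u c → glue u c (x' ⊕ x)) (⊕-Props.interchange x' y' x y) middle)
    where
    middle : (parity x' xor lam y') xor parity x ≡ parity (x' ⊕ x) xor lam y'
    middle = trans (xor-Props.xy∙z≈xz∙y (parity x') (lam y') (parity x)) (cong (_xor lam y') (sym (parity-⊕ x' x)))

  OffsetTriple : Subset (n + suc n) → Set
  OffsetTriple T = Σ (Word n) λ a → Σ (Word n) λ y' → y' ∈C C × ∣ offset a y' ∣ ≡ 3 × offset a y' ≡ T

  STS⇔OffsetTriple : ∀ T → STS (V C lam) z T ⇔ OffsetTriple T
  STS⇔OffsetTriple T = mk⇔ to from
    where
    to : STS (V C lam) z T → OffsetTriple T
    to (_ , (x' , y' , y'∈C , refl) , w3 , eT) =
      x' ⊕ x , y' , y'∈C , trans (cong ∣_∣ (sym (codeword-offset x' y'))) w3 , trans (sym (codeword-offset x' y')) eT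
    from : OffsetTriple T → STS (V C lam) z T
    from (a , y' , y'∈C , w3 , eT) =
      codeword (a ⊕ x) y' , (a ⊕ x , y' , y'∈C , refl) , trans (cong ∣_∣ shift) w3 , trans shift eT
      where
      shift : codeword (a ⊕ x) y' ⊕ z ≡ offset a y'
      shift = trans (codeword-offset (a ⊕ x) y') (cong (λ b → offset b y') (⊕-cancelʳ a x))

  offset-at-y : ∀ a → offset a y ≡ glue a (parity a) a
  offset-at-y a = cong₂ (λ u c → glue u c a) (trans (cong (a ⊕_) (⊕-self y)) (⊕-identityʳ a))
                                             (trans (cong (parity a xor_) λy≡0) (xor-identityʳ (parity a)))

  axis-offset : ∀ i → offset ⁅ i ⁆ y ≡ tri (L i) M (R i)
  axis-offset i = trans (offset-at-y ⁅ i ⁆) (trans (cong (λ c → glue ⁅ i ⁆ c ⁅ i ⁆) (parity-⁅⁆ i)) (sym (axis-glue i)))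

  axis-case : ∀ a → ∣ offset a y ∣ ≡ 3 → Axis (offset a y)
  axis-case a w3 with ∣p∣≡1⇒singleton a (A+c+A≡3⇒A≡1 ∣ a ∣ (parity a) weight)
    where
    weight : ∣ a ∣ + (bit (parity a) + ∣ a ∣) ≡ 3
    weight = trans (sym (∣glue∣ a (parity a) a)) (trans (cong ∣_∣ (sym (offset-at-y a))) w3)
  ... | i , refl = i , axis-offset i

  module _ {i j k : Fin n} {y' : Word n} (b3 : ∣ y' ⊕ y ∣ ≡ 3) (eb : y' ⊕ y ≡ tri i j k)
           (a b c : Bool) (λy'≡ : lam y' ≡ a xor (b xor c)) where

    private
      s : Subset n
      s = sub i j k a b c

      t3 : ∣ tri i j k ∣ ≡ 3
      t3 = trans (cong ∣_∣ (sym eb)) b3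

    lifted-parity : parity s xor lam y' ≡ false
    lifted-parity = trans (cong₂ _xor_ (parity-sub (triple-distinct i j k t3) a b c) λy'≡) (xor-same (a xor (b xor c)))

    lifted-offset : offset s y' ≡ lift i j k a b c
    lifted-offset = trans (cong₂ (λ u m → glue u m s)
                                 (trans (cong (s ⊕_) eb) (sub-⊕-tri (triple-distinct i j k t3) a b c)) lifted-parity)
                          (sym (lift-glue i j k a b c))

    lifted-weight : ∣ offset s y' ∣ ≡ 3
    lifted-weight = begin
      ∣ offset s y' ∣
        ≡⟨ ∣glue-sum∣ s (y' ⊕ y) _ ⟩
      bit (parity s xor lam y') + (∣ y' ⊕ y ∣ + (∣ s ─ (y' ⊕ y) ∣ + ∣ s ─ (y' ⊕ y) ∣))
        ≡⟨ cong₂ (λ m p → bit m + (∣ p ∣ + (∣ s ─ p ∣ + ∣ s ─ p ∣))) lifted-parity eb ⟩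
      ∣ tri i j k ∣ + (∣ s ─ tri i j k ∣ + ∣ s ─ tri i j k ∣)
        ≡⟨ cong (λ p → ∣ tri i j k ∣ + (∣ p ∣ + ∣ p ∣)) (sub─tri i j k a b c) ⟩
      ∣ tri i j k ∣ + (∣ ∅ {n} ∣ + ∣ ∅ {n} ∣)
        ≡⟨ cong₂ (λ t e → t + (e + e)) t3 (∣⊥∣≡0 n) ⟩
      3 ∎
      where open ≡-Reasoning

  -- Offsets with y' ≠ y: since d(y, y') ≥ 3, weight 3 forces d(y, y') = 3, a ⊆ y + y'
  -- and |a| = λ(y'), so the offset is a lift of the triple supp(y + y') ∈ STS(C, y).
  lifted-case : ∀ a y' → y' ∈C C → ¬ y' ≡ y → ∣ offset a y' ∣ ≡ 3 → Lifted S θ (offset a y')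
  lifted-case a y' y'∈C y'≢y w3
    with c+B+2d≡3 (parity a xor lam y') ∣ y' ⊕ y ∣ ∣ a ─ (y' ⊕ y) ∣ (trans (sym (∣glue-sum∣ a (y' ⊕ y) _)) w3)
                  (perfect-min-distance C perf y'∈C y∈C y'≢y)
  ... | balanced , b3 , a⊆b with ∣p∣≡3⇒triple (y' ⊕ y) b3
  ...   | i , j , k , eb = i , j , k , s , α , β , γ , trans (θ-value s) λy'≡ , offset≡lift
    where
    s : S (tri i j k)
    s = y' , y'∈C , b3 , eb
    α β γ : Bool
    α = lookup a i
    β = lookup a j
    γ = lookup a k
    a≡sub : a ≡ sub i j k α β γ
    a≡sub = ⊆tri⇒sub a i j k (subst (λ p → a ─ p ≡ ∅) eb (∣p∣≡0⇒p≡∅ _ a⊆b))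
    λy'≡ : lam y' ≡ α xor (β xor γ)
    λy'≡ = trans (xor≡false⇒≡ (parity a) (lam y') balanced)
                 (trans (cong parity a≡sub) (parity-sub (triple-distinct i j k (trans (cong ∣_∣ (sym eb)) b3)) α β γ))
    offset≡lift : offset a y' ≡ lift i j k α β γ
    offset≡lift = trans (cong (λ p → offset p y') a≡sub) (lifted-offset b3 eb α β γ λy'≡)

  OffsetTriple⇔Axis⊎Lifted : ∀ T → OffsetTriple T ⇔ (Axis T ⊎ Lifted S θ T)
  OffsetTriple⇔Axis⊎Lifted T = mk⇔ to from
    where
    to : OffsetTriple T → Axis T ⊎ Lifted S θ T
    to (a , y' , y'∈C , w3 , refl) with ≡-dec Bool._≟_ y' y
    ... | yes refl = inj₁ (axis-case a w3)
    ... | no y'≢y = inj₂ (lifted-case a y' y'∈C y'≢y w3)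

    from : Axis T ⊎ Lifted S θ T → OffsetTriple T
    from (inj₁ (i , refl)) =
      ⁅ i ⁆ , y , y∈C , trans (cong ∣_∣ (axis-offset i)) (axis-weight i) , axis-offset i
    from (inj₂ (i , j , k , s@(y' , y'∈C , b3 , eb) , a , b , c , θ≡ , refl)) =
      sub i j k a b c , y' , y'∈C , lifted-weight b3 eb a b c λy'≡ , lifted-offset b3 eb a b c λy'≡
      where
      λy'≡ : lam y' ≡ a xor (b xor c)
      λy'≡ = trans (sym (θ-value s)) θ≡

mainTheorem6 : (k n : ℕ) → n + 1 ≡ 2 ^ k →
    (C : Code n) → IsPerfect C → zeroWord n ∈C C →
    (lam : Word n → Bool) → lam (zeroWord n) ≡ false →
    (x y : Word n) → y ∈C C →
    V C lam ((x ⊕ y) ++ (parity x ∷ x)) →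
    (T : Subset (n + suc n)) →
    STS (V C lam) ((x ⊕ y) ++ (parity x ∷ x)) T ⇔ AM (STS (λ v → v ∈C C) y) (θC C lam y) T
mainTheorem6 _ _ _ C perf _ lam _ x y y∈C z∈V T =
  ⇔-trans (STS⇔OffsetTriple T) (⇔-trans (OffsetTriple⇔Axis⊎Lifted T) (⇔-sym (AM⇔Axis⊎Lifted S θ T)))
  where open Derivation C perf lam x y y∈C (glue-in-V⇒λ≡0 z∈V)
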